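{- Let $k,n\in\mathbb{N}$ with $k<n$ and let $T$ be the set of words over $\{v_{1},\dots,v_{k}\}$ in which $v_{i}$ occurs for each $i\in\{1,\dots,k\}$. For $w\in S_{n}$ let $\tau(w)\in T$ be obtained from $w$ by deleting all occurrences of elements of $\mathbb{A}$ as well as all occurrences of $v_{i}$ for $k<i\leq n$. Let $\langle y_{t}\rangle_{t=1}^{\infty}$ be a sequence in $T$ and let $D\subseteq S_{0}$ be a $J$-set in $(S_0,\cdot)$. Then there exists a sequence $\langle w_{t}\rangle_{t=1}^{\infty}$ in $S_{n}$ such that $\{w_{m}(\vec{a}):\vec{a}\in\mathbb{A}_{m}^{n}\}\subseteq D$ for all $m\in\mathbb{N}$, and for every finite nonempty $G=\{m_{1}<m_{2}<\cdots<m_{l}\}\subseteq\mathbb{N}$, \[ \tau(w_{m_{1}})\tau(w_{m_{2}})\cdots\tau(w_{m_{l}})\in\mathrm{FP}(\langle y_{t}\rangle_{t=1}^{\infty}). \]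
   Context: Let $\mathbb{A}_{1}\subseteq\mathbb{A}_{2}\subseteq\cdots$ be an increasing sequence of finite nonempty alphabets and $\mathbb{A}=\bigcup_{i}\mathbb{A}_{i}$. $S_{0}$ is the set of all nonempty finite words over $\mathbb{A}$, a semigroup under concatenation. $v_{1},\dots,v_{n}$ are distinct variables not in $\mathbb{A}$; $S_{n}$ is the set of words over $\mathbb{A}\cup\{v_{1},\dots,v_{n}\}$ in which each $v_{i}$ occurs at least once. For $w\in S_{n}$ and $\vec{a}=(a_{1},\dots,a_{n})\in\mathbb{A}^{n}$, $w(\vec{a})$ is obtained by replacing each occurrence of $v_{i}$ by $a_{i}$. Products in $T$ are concatenations, and $\mathrm{FP}(\langle y_{t}\rangle)=\{y_{t_{1}}y_{t_{2}}\cdots y_{t_{r}}:r\in\mathbb{N},\ t_{1}<t_{2}<\cdots<t_{r}\}$. For a semigroup $S$, $B\subseteq S$ is a $J$-set if for every finite nonempty set $F$ of sequences $f:\mathbb{N}\to S$ there exist $m\in\mathbb{N}$, $a_{1},\dots,a_{m+1}\in S$ and $t_{1}<\cdots<t_{m}$ in $\mathbb{N}$ with $a_{1}f(t_{1})\cdots a_{m}f(t_{m})a_{m+1}\in B$ for all $f\in F$. -}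

module Defs where

open import Data.Nat using (ℕ; zero; suc; _<_; _<?_)
open import Data.Fin as Fin using (Fin; toℕ; fromℕ<)
open import Data.List using (List; []; _∷_; _++_; map; mapMaybe)
open import Data.List.NonEmpty using (List⁺)
open import Data.List.Relation.Unary.All using (All)
open import Data.List.Membership.Propositional using (_∈_)
open import Data.Maybe using (Maybe; just; nothing)
open import Data.Sum using (_⊎_; inj₁; inj₂; [_,_])
open import Data.Product using (Σ; ∃; ∃-syntax; _×_)
open import Relation.Binary.PropositionalEquality using (_≢_; _≡_)
open import Relation.Nullary using (yes; no)
open import Function using (id; _∘_)

StrictlyIncreasing : ∀ {r} → (Fin r → ℕ) → Set
StrictlyIncreasing t = ∀ {i j} → i Fin.< j → t i < t j

-- a₀ x₀ a₁ x₁ ⋯ a_{m-1} x_{m-1} a_m   (right-nested; semigroup is associative)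
interleave : ∀ {A : Set} (_∙_ : A → A → A) {m : ℕ} → (Fin (suc m) → A) → (Fin m → A) → A
interleave _∙_ {zero}  a x = a Fin.zero
interleave _∙_ {suc m} a x = a Fin.zero ∙ (x Fin.zero ∙ interleave _∙_ (a ∘ Fin.suc) (x ∘ Fin.suc))

-- J-set in a semigroup (A, ∙).  Finite nonempty F given as a nonempty list;
-- m ∈ ℕ = {1,2,...} is encoded as suc m.
JSet : ∀ {A : Set} (_∙_ : A → A → A) → (A → Set) → Set
JSet {A} _∙_ B =
  (F : List⁺ (ℕ → A)) →
  ∃[ m ] Σ (Fin (suc (suc m)) → A) λ a → Σ (Fin (suc m) → ℕ) λ t →
    StrictlyIncreasing t × All (λ f → B (interleave _∙_ a (f ∘ t))) (Data.List.NonEmpty.toList F)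

concatF : ∀ {X : Set} {r : ℕ} → (Fin r → List X) → List X
concatF {r = zero}  w = []
concatF {r = suc r} w = w Fin.zero ++ concatF (w ∘ Fin.suc)

-- words over 𝔸 ∪ {v₁,…,vₙ}: letters inj₁, variable v_{i+1} is inj₂ i
Word : Set → ℕ → Set
Word L n = List (L ⊎ Fin n)

InS : ∀ {L : Set} (n : ℕ) → Word L n → Set
InS n w = (w ≢ []) × (∀ (i : Fin n) → inj₂ i ∈ w)

substW : ∀ {L : Set} {n : ℕ} → Word L n → (Fin n → L) → List L
substW w a = map [ id , a ] w

InT : (k : ℕ) → List (Fin k) → Set
InT k u = ∀ (i : Fin k) → i ∈ u

restrictVar : ∀ {L : Set} {n : ℕ} (k : ℕ) → L ⊎ Fin n → Maybe (Fin k)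
restrictVar k (inj₁ _) = nothing
restrictVar k (inj₂ i) with toℕ i <? k
... | yes p = just (fromℕ< p)
... | no _  = nothing

τ : ∀ {L : Set} {n : ℕ} (k : ℕ) → Word L n → List (Fin k)
τ k w = mapMaybe (restrictVar k) w

-- FP(⟨y_t⟩): r ∈ ℕ = {1,2,...} encoded as suc r
FP : ∀ {X : Set} → (ℕ → List X) → List X → Set
FP y u = ∃[ r ] Σ (Fin (suc r) → ℕ) λ t → StrictlyIncreasing t × (u ≡ concatF (y ∘ t))

-- For t ∈ ℕ let U(t) be the word v_{k+1} ⋯ v_n y_t, so that U(t) contains every variable and
-- τ(U(t)) = y_t.  For each m apply the J-set property of D to the finitely many sequences
-- t ↦ U(t)(a⃗), a⃗ ∈ 𝔸_m^n, shifted beyond every index used for w_1, …, w_{m-1}: this gives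
-- w_m = a_1 U(t_1) a_2 ⋯ a_r U(t_r) a_{r+1} with w_m(a⃗) ∈ D and τ(w_m) = y_{t_1} ⋯ y_{t_r}.
-- The index blocks of successive w_m lie in disjoint consecutive intervals, so
-- τ(w_{m_1}) ⋯ τ(w_{m_l}) is a product of y_t along a strictly increasing sequence of indices,
-- i.e. an element of FP(⟨y_t⟩).

module Submission where

open import Defs
open import Data.Nat using (ℕ; zero; suc; _<_; _≤_; _+_; z≤n; s≤s; _≤?_; _<?_; _≤′_; ≤′-refl; ≤′-step)
open import Data.Nat.Properties using (≤-trans; ≤-refl; <-irrefl; m≤n+m; +-monoˡ-<; ≤⇒≤′; <⇒≤; n≤1+n; ≮⇒≥)
open import Data.Fin as Fin using (Fin; toℕ; fromℕ; fromℕ<; inject≤)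
open import Data.Fin.Properties using (toℕ-injective; toℕ-fromℕ<; toℕ-inject≤; toℕ<n)
open import Data.List as List using (List; []; _∷_; _++_; map; mapMaybe; concatMap; allFin; tabulate; filter; cartesianProductWith)
open import Data.List.Properties using (map-++; map-cong; map-∘; map-id; concatMap-++; mapMaybe-++; mapMaybe-map; mapMaybe-cong; mapMaybe-just; tabulate-lookup)
open import Data.List.NonEmpty as List⁺ using (List⁺; _⁺++⁺_; toList)
open import Data.List.Membership.Propositional using (_∈_)
open import Data.List.Membership.Propositional.Properties using (∈-map⁺; ∈-++⁺ˡ; ∈-++⁺ʳ; ∈-allFin; ∈-filter⁺; ∈-cartesianProductWith⁺)
open import Data.List.Relation.Unary.Any using (here; there)
open import Data.List.Relation.Unary.All as All using (All)
open import Data.List.Relation.Unary.All.Properties using (all-filter)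
open import Data.Maybe using (Maybe; just; nothing)
open import Data.Sum using (_⊎_; inj₁; inj₂; [_,_])
open import Data.Product using (Σ; ∃-syntax; _×_; _,_; proj₁; proj₂)
open import Data.Vec.Functional as Vector using (Vector)
open import Data.Empty using (⊥-elim)
open import Relation.Nullary using (¬_; yes; no; contradiction)
open import Relation.Binary.PropositionalEquality using (_≡_; _≢_; _≗_; refl; sym; trans; cong; cong₂; subst; module ≡-Reasoning)
open import Function using (_∘_; id)

interleave-hom : {A B : Set} (_∙_ : A → A → A) (_◦_ : B → B → B) (φ : A → B) →
  (∀ x y → φ (x ∙ y) ≡ φ x ◦ φ y) →
  ∀ {m} (a : Fin (suc m) → A) (x : Fin m → A) →
  φ (interleave _∙_ a x) ≡ interleave _◦_ (φ ∘ a) (φ ∘ x)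
interleave-hom _∙_ _◦_ φ hom {zero}  a x = refl
interleave-hom _∙_ _◦_ φ hom {suc m} a x = begin
  φ (a Fin.zero ∙ (x Fin.zero ∙ rest))         ≡⟨ hom _ _ ⟩
  φ (a Fin.zero) ◦ φ (x Fin.zero ∙ rest)       ≡⟨ cong (φ (a Fin.zero) ◦_) (hom _ _) ⟩
  φ (a Fin.zero) ◦ (φ (x Fin.zero) ◦ φ rest)   ≡⟨ cong (λ z → φ (a Fin.zero) ◦ (φ (x Fin.zero) ◦ z))
                                                     (interleave-hom _∙_ _◦_ φ hom (a ∘ Fin.suc) (x ∘ Fin.suc)) ⟩
  interleave _◦_ (φ ∘ a) (φ ∘ x)               ∎
  where
  open ≡-Reasoning
  rest = interleave _∙_ (a ∘ Fin.suc) (x ∘ Fin.suc)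

interleave-cong : {A : Set} (_∙_ : A → A → A) → ∀ {m} {a a′ : Fin (suc m) → A} {x x′ : Fin m → A} →
  a ≗ a′ → x ≗ x′ → interleave _∙_ a x ≡ interleave _∙_ a′ x′
interleave-cong _∙_ {zero}  a≗a′ x≗x′ = a≗a′ Fin.zero
interleave-cong _∙_ {suc m} a≗a′ x≗x′ =
  cong₂ _∙_ (a≗a′ Fin.zero)
    (cong₂ _∙_ (x≗x′ Fin.zero) (interleave-cong _∙_ (a≗a′ ∘ Fin.suc) (x≗x′ ∘ Fin.suc)))

interleave-[] : {X : Set} → ∀ {m} (a : Fin (suc m) → List X) (x : Fin m → List X) →
  (∀ i → a i ≡ []) → interleave _++_ a x ≡ concatF x
interleave-[] {m = zero}  a x a≡[] = a≡[] Fin.zero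
interleave-[] {m = suc m} a x a≡[] rewrite a≡[] Fin.zero =
  cong (x Fin.zero ++_) (interleave-[] (a ∘ Fin.suc) (x ∘ Fin.suc) (a≡[] ∘ Fin.suc))

concatF-cong : {X : Set} → ∀ {r} {u v : Fin r → List X} → u ≗ v → concatF u ≡ concatF v
concatF-cong {r = zero}  u≗v = refl
concatF-cong {r = suc r} u≗v = cong₂ _++_ (u≗v Fin.zero) (concatF-cong (u≗v ∘ Fin.suc))

concatF-tabulate : {A B : Set} (f : A → List B) → ∀ {r} (h : Fin r → A) →
  concatF (f ∘ h) ≡ concatMap f (tabulate h)
concatF-tabulate f {zero}  h = refl
concatF-tabulate f {suc r} h = cong (f (h Fin.zero) ++_) (concatF-tabulate f (h ∘ Fin.suc))

concatMap-concatF : {A B : Set} (f : A → List B) → ∀ {r} (xs : Fin r → List A) →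
  concatMap f (concatF xs) ≡ concatF (concatMap f ∘ xs)
concatMap-concatF f {zero}  xs = refl
concatMap-concatF f {suc r} xs =
  trans (concatMap-++ f (xs Fin.zero) (concatF (xs ∘ Fin.suc)))
        (cong (concatMap f (xs Fin.zero) ++_) (concatMap-concatF f (xs ∘ Fin.suc)))

mapMaybe-All-nothing : {A B : Set} (f : A → Maybe B) {xs : List A} →
  All (λ x → f x ≡ nothing) xs → mapMaybe f xs ≡ []
mapMaybe-All-nothing f All.[] = refl
mapMaybe-All-nothing f (fx≡nothing All.∷ rest) rewrite fx≡nothing = mapMaybe-All-nothing f rest

allFunctions : {A : Set} (n : ℕ) → List A → List (Vector A n)
allFunctions zero    xs = Vector.[] ∷ []
allFunctions (suc n) xs = cartesianProductWith Vector._∷_ xs (allFunctions n xs)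

allFunctions-complete : {A : Set} (n : ℕ) (xs : List A) (f : Vector A n) → (∀ i → f i ∈ xs) →
  ∃[ g ] g ∈ allFunctions n xs × g ≗ f
allFunctions-complete zero    xs f f∈xs = Vector.[] , here refl , λ ()
allFunctions-complete (suc n) xs f f∈xs
  with g , g∈ , g≗ ← allFunctions-complete n xs (f ∘ Fin.suc) (f∈xs ∘ Fin.suc) =
  f Fin.zero Vector.∷ g , ∈-cartesianProductWith⁺ Vector._∷_ (f∈xs Fin.zero) g∈ , cons≗
  where
  cons≗ : (f Fin.zero Vector.∷ g) ≗ f
  cons≗ Fin.zero    = refl
  cons≗ (Fin.suc i) = g≗ i

-- Ascending b c xs: xs is strictly increasing with all entries in [b, c).
data Ascending : ℕ → ℕ → List ℕ → Set where
  nil  : ∀ {b c} → b ≤ c → Ascending b c []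
  cons : ∀ {b c x xs} → b ≤ x → Ascending (suc x) c xs → Ascending b c (x ∷ xs)

Ascending-≤ : ∀ {b c xs} → Ascending b c xs → b ≤ c
Ascending-≤ (nil b≤c)      = b≤c
Ascending-≤ (cons b≤x asc) = ≤-trans b≤x (≤-trans (n≤1+n _) (Ascending-≤ asc))

Ascending-weaken : ∀ {b c d xs} → Ascending b c xs → c ≤ d → Ascending b d xs
Ascending-weaken (nil b≤c)      c≤d = nil (≤-trans b≤c c≤d)
Ascending-weaken (cons b≤x asc) c≤d = cons b≤x (Ascending-weaken asc c≤d)

Ascending-++ : ∀ {b c d xs ys} → Ascending b c xs → Ascending c d ys → Ascending b d (xs ++ ys)
Ascending-++ (nil b≤c)      (nil c≤d)      = nil (≤-trans b≤c c≤d)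
Ascending-++ (nil b≤c)      (cons c≤y asc) = cons (≤-trans b≤c c≤y) asc
Ascending-++ (cons b≤x asc) asc′           = cons b≤x (Ascending-++ asc asc′)

Ascending-lookup-≥ : ∀ {b c xs} → Ascending b c xs → ∀ i → b ≤ List.lookup xs i
Ascending-lookup-≥ (cons b≤x asc) Fin.zero    = b≤x
Ascending-lookup-≥ (cons b≤x asc) (Fin.suc i) = ≤-trans b≤x (≤-trans (n≤1+n _) (Ascending-lookup-≥ asc i))

Ascending-lookup : ∀ {b c xs} → Ascending b c xs → StrictlyIncreasing (List.lookup xs)
Ascending-lookup (cons _ asc) {Fin.zero}  {Fin.suc j} _         = Ascending-lookup-≥ asc j
Ascending-lookup (cons _ asc) {Fin.suc i} {Fin.suc j} (s≤s i<j) = Ascending-lookup asc i<j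

tabulate-Ascending : ∀ {b} r (h : Fin (suc r) → ℕ) → StrictlyIncreasing h → b ≤ h Fin.zero →
  Ascending b (suc (h (fromℕ r))) (tabulate h)
tabulate-Ascending zero    h h↑ b≤h₀ = cons b≤h₀ (nil ≤-refl)
tabulate-Ascending (suc r) h h↑ b≤h₀ =
  cons b≤h₀ (tabulate-Ascending r (h ∘ Fin.suc) (λ i<j → h↑ (s≤s i<j)) (h↑ (s≤s z≤n)))

module _ (s : ℕ → ℕ) (blocks : ℕ → List ℕ) (blocks-Ascending : ∀ m → Ascending (s m) (s (suc m)) (blocks m)) where

  private
    s-mono : ∀ {m m′} → m ≤′ m′ → s m ≤ s m′
    s-mono ≤′-refl       = ≤-refl
    s-mono (≤′-step m≤m′) = ≤-trans (s-mono m≤m′) (Ascending-≤ (blocks-Ascending _))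

  concatF-Ascending : ∀ l (g : Fin (suc l) → ℕ) → StrictlyIncreasing g →
    ∃[ c ] Ascending (s (g Fin.zero)) c (concatF (blocks ∘ g))
  concatF-Ascending zero    g g↑ = _ , Ascending-++ (blocks-Ascending (g Fin.zero)) (nil ≤-refl)
  concatF-Ascending (suc l) g g↑ with c , asc ← concatF-Ascending l (g ∘ Fin.suc) (λ i<j → g↑ (s≤s i<j)) =
    c , Ascending-++ (Ascending-weaken (blocks-Ascending (g Fin.zero)) (s-mono (≤⇒≤′ (g↑ (s≤s z≤n))))) asc

Ascending⇒FP : {X : Set} (y : ℕ → List X) → ∀ {b c x xs} → Ascending b c (x ∷ xs) → FP y (concatMap y (x ∷ xs))
Ascending⇒FP y {x = x} {xs} asc =
  List.length xs , List.lookup (x ∷ xs) , Ascending-lookup asc ,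
  sym (trans (concatF-tabulate y (List.lookup (x ∷ xs))) (cong (concatMap y) (tabulate-lookup (x ∷ xs))))

module _ {L : Set} {n : ℕ} where

  substW⁺ : List⁺ (L ⊎ Fin n) → (Fin n → L) → List⁺ L
  substW⁺ w a = List⁺.map [ id , a ] w

  substW-cong : (w : Word L n) {a b : Fin n → L} → a ≗ b → substW w a ≡ substW w b
  substW-cong w a≗b = map-cong [ (λ _ → refl) , a≗b ] w

  substW-letters : (l : List L) (a : Fin n → L) → substW (map inj₁ l) a ≡ l
  substW-letters l a = trans (sym (map-∘ l)) (map-id l)

  record Interleaving (U : ℕ → List⁺ (L ⊎ Fin n)) : Set where
    field
      r                : ℕ
      gaps             : Fin (suc (suc r)) → List⁺ L
      times            : Fin (suc r) → ℕ
      times-increasing : StrictlyIncreasing times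

    word : Word L n
    word = interleave _++_ (map inj₁ ∘ toList ∘ gaps) (toList ∘ U ∘ times)

    indices : List ℕ
    indices = tabulate times

    nextFree : ℕ
    nextFree = suc (times (fromℕ r))

    ∈-word : ∀ {x} → x ∈ toList (U (times Fin.zero)) → x ∈ word
    ∈-word x∈ = ∈-++⁺ʳ (map inj₁ (toList (gaps Fin.zero))) (∈-++⁺ˡ x∈)

    indices-Ascending : ∀ {b} → b ≤ times Fin.zero → Ascending b nextFree indices
    indices-Ascending = tabulate-Ascending r times times-increasing

  open Interleaving public

  InstancesIn : (D : List⁺ L → Set) → List⁺ (Fin n → L) → Word L n → Set
  InstancesIn D as w = ∀ {a} → a ∈ toList as → Σ (List⁺ L) λ u → toList u ≡ substW w a × D u

  JSet⇒Interleaving : {D : List⁺ L → Set} → JSet _⁺++⁺_ D →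
    (U : ℕ → List⁺ (L ⊎ Fin n)) (as : List⁺ (Fin n → L)) (s : ℕ) →
    Σ (Interleaving U) λ I → s ≤ times I Fin.zero × InstancesIn D as (word I)
  JSet⇒Interleaving J U as s
    with r , gaps , t , t↑ , inD ← J (List⁺.map (λ a t → substW⁺ (U (t + s)) a) as) =
    I , m≤n+m s (t Fin.zero) , λ a∈ → _ , substW-word _ , All.lookup inD (∈-map⁺ _ a∈)
    where
    I : Interleaving U
    I = record { r = r ; gaps = gaps ; times = λ j → t j + s ; times-increasing = λ i<j → +-monoˡ-< s (t↑ i<j) }

    substW-word : ∀ a → toList (interleave _⁺++⁺_ gaps (λ j → substW⁺ (U (times I j)) a)) ≡ substW (word I) a
    substW-word a = begin
      toList (interleave _⁺++⁺_ gaps (λ j → substW⁺ (U (times I j)) a))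
        ≡⟨ interleave-hom _⁺++⁺_ _++_ toList (λ _ _ → refl) gaps (λ j → substW⁺ (U (times I j)) a) ⟩
      interleave _++_ (toList ∘ gaps) instancesOfU
        ≡⟨ interleave-cong _++_ {x = instancesOfU} (λ i → sym (substW-letters (toList (gaps i)) a)) (λ _ → refl) ⟩
      interleave _++_ (λ i → substW (map inj₁ (toList (gaps i))) a) instancesOfU
        ≡⟨ sym (interleave-hom _++_ _++_ (λ w → substW w a) (map-++ [ id , a ]) (map inj₁ ∘ toList ∘ gaps) (toList ∘ U ∘ times I)) ⟩
      substW (word I) a ∎
      where
      open ≡-Reasoning
      instancesOfU : Fin (suc r) → List L
      instancesOfU j = substW (toList (U (times I j))) a

  τ-letters : (k : ℕ) (l : List L) → τ {n = n} k (map inj₁ l) ≡ []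
  τ-letters k []      = refl
  τ-letters k (_ ∷ l) = τ-letters k l

  τ-word : (k : ℕ) {U : ℕ → List⁺ (L ⊎ Fin n)} (I : Interleaving U) →
    τ k (word I) ≡ concatF (τ k ∘ toList ∘ U ∘ times I)
  τ-word k {U} I =
    trans (interleave-hom _++_ _++_ (τ k) (mapMaybe-++ (restrictVar k)) (map inj₁ ∘ toList ∘ gaps I) (toList ∘ U ∘ times I))
          (interleave-[] (τ k ∘ map inj₁ ∘ toList ∘ gaps I) (τ k ∘ toList ∘ U ∘ times I) (τ-letters k ∘ toList ∘ gaps I))

module _ {L : Set} {k n : ℕ} where

  restrictVar-≥ : ∀ {i : Fin n} → k ≤ toℕ i → restrictVar {L} k (inj₂ i) ≡ nothing
  restrictVar-≥ {i} k≤i with toℕ i <? k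
  ... | yes i<k = contradiction (≤-trans i<k k≤i) (<-irrefl refl)
  ... | no _    = refl

  restrictVar-inject≤ : (j : Fin k) .(k≤n : k ≤ n) → restrictVar {L} k (inj₂ (inject≤ j k≤n)) ≡ just j
  restrictVar-inject≤ j k≤n with toℕ (inject≤ j k≤n) <? k
  ... | yes j<k = cong just (toℕ-injective (trans (toℕ-fromℕ< j<k) (toℕ-inject≤ j k≤n)))
  ... | no j≮k  = contradiction (subst (_< k) (sym (toℕ-inject≤ j k≤n)) (toℕ<n j)) j≮k

module _ {k n : ℕ} (k<n : k < n) where

  pivot : Fin n
  pivot = fromℕ< k<n

  upperVars : List (Fin n)
  upperVars = filter (λ i → k ≤? toℕ i) (allFin n)

  lower : Fin k → Fin n
  lower j = inject≤ j (<⇒≤ k<n)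

  module _ {L : Set} where

    -- U(t): the pivot v_{k+1} makes the word visibly nonempty; it is repeated in upperVars.
    block : (y : List (Fin k)) → List⁺ (L ⊎ Fin n)
    block y = inj₂ pivot List⁺.∷ (map inj₂ upperVars ++ map (inj₂ ∘ lower) y)

    τ-block : ∀ y → τ k (toList (block y)) ≡ y
    τ-block y = begin
      τ k (map inj₂ (pivot ∷ upperVars) ++ map (inj₂ ∘ lower) y)
        ≡⟨ mapMaybe-++ (restrictVar k) (map inj₂ (pivot ∷ upperVars)) _ ⟩
      τ k (map inj₂ (pivot ∷ upperVars)) ++ τ k (map (inj₂ ∘ lower) y)
        ≡⟨ cong₂ _++_ τ-upper τ-lower ⟩
      y ∎
      where
      open ≡-Reasoning
      upper≥k : All (λ i → k ≤ toℕ i) (pivot ∷ upperVars)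
      upper≥k = subst (k ≤_) (sym (toℕ-fromℕ< k<n)) ≤-refl All.∷ all-filter (λ i → k ≤? toℕ i) (allFin n)

      τ-upper : τ k (map inj₂ (pivot ∷ upperVars)) ≡ []
      τ-upper = trans (mapMaybe-map (restrictVar k) inj₂ (pivot ∷ upperVars))
                      (mapMaybe-All-nothing _ (All.map (restrictVar-≥ {L = L}) upper≥k))

      τ-lower : τ k (map (inj₂ ∘ lower) y) ≡ y
      τ-lower = begin
        τ k (map (inj₂ ∘ lower) y)         ≡⟨ mapMaybe-map (restrictVar k) (inj₂ ∘ lower) y ⟩
        mapMaybe (restrictVar {L} k ∘ inj₂ ∘ lower) y ≡⟨ mapMaybe-cong (λ j → restrictVar-inject≤ {L = L} j (<⇒≤ k<n)) y ⟩
        mapMaybe just y                     ≡⟨ mapMaybe-just y ⟩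
        y                                   ∎

    ∈-block : ∀ {y} → InT k y → ∀ i → inj₂ i ∈ toList (block y)
    ∈-block {y} y∈T i with toℕ i <? k
    ... | yes i<k = there (∈-++⁺ʳ (map inj₂ upperVars)
                      (subst (λ j → inj₂ j ∈ map (inj₂ ∘ lower) y) lower-i (∈-map⁺ (inj₂ ∘ lower) (y∈T _))))
      where
      lower-i : lower (fromℕ< i<k) ≡ i
      lower-i = toℕ-injective (trans (toℕ-inject≤ _ _) (toℕ-fromℕ< i<k))
    ... | no i≮k  = there (∈-++⁺ˡ (∈-map⁺ inj₂ (∈-filter⁺ (λ j → k ≤? toℕ j) (∈-allFin i) (≮⇒≥ i≮k))))

module Construction (L : Set) (Alph : ℕ → List L) (x₀ : L) (k n : ℕ) (k<n : k < n)
                    (y : ℕ → List (Fin k)) (D : List⁺ L → Set) (J : JSet _⁺++⁺_ D) where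

  U : ℕ → List⁺ (L ⊎ Fin n)
  U = block k<n ∘ y

  -- x₀ only makes the list of substitutions nonempty.
  substitutions : ℕ → List⁺ (Fin n → L)
  substitutions m = (λ _ → x₀) List⁺.∷ allFunctions n (Alph m)

  stage : ∀ m s → Σ (Interleaving U) λ I → s ≤ times I Fin.zero × InstancesIn D (substitutions m) (word I)
  stage m = JSet⇒Interleaving J U (substitutions m)

  offset : ℕ → ℕ
  interleavingAt : ℕ → Interleaving U

  offset zero    = 0
  offset (suc m) = nextFree (interleavingAt m)

  interleavingAt m = proj₁ (stage m (offset m))

  w : ℕ → Word L n
  w m = word (interleavingAt m)

  indicesAt : ℕ → List ℕ
  indicesAt m = indices (interleavingAt m)

  w∈S : (∀ t → InT k (y t)) → ∀ m → InS n (w m)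
  w∈S y∈T m = (λ w≡[] → ¬pivot∈[] (subst (inj₂ (pivot k<n) ∈_) w≡[] (var∈w (pivot k<n)))) , var∈w
    where
    var∈w : ∀ i → inj₂ i ∈ w m
    var∈w i = ∈-word (interleavingAt m) (∈-block k<n (y∈T _) i)
    ¬pivot∈[] : ¬ (inj₂ (pivot k<n) ∈ [])
    ¬pivot∈[] ()

  w-instances : ∀ m (a : Fin n → L) → (∀ i → a i ∈ Alph m) →
    Σ (List⁺ L) λ u → (toList u ≡ substW (w m) a) × D u
  w-instances m a a∈Alph with b , b∈ , b≗a ← allFunctions-complete n (Alph m) a a∈Alph
    with u , u≡ , u∈D ← proj₂ (proj₂ (stage m (offset m))) (there b∈) =
    u , trans u≡ (substW-cong (w m) b≗a) , u∈D

  τ-w : ∀ m → τ k (w m) ≡ concatMap y (indicesAt m)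
  τ-w m = begin
    τ k (w m)                                       ≡⟨ τ-word k (interleavingAt m) ⟩
    concatF (τ k ∘ toList ∘ U ∘ times I)            ≡⟨ concatF-cong (λ j → τ-block k<n {L} (y (times I j))) ⟩
    concatF (y ∘ times I)                           ≡⟨ concatF-tabulate y (times I) ⟩
    concatMap y (indices I)                         ∎
    where
    open ≡-Reasoning
    I : Interleaving U
    I = interleavingAt m

  indicesAt-Ascending : ∀ m → Ascending (offset m) (offset (suc m)) (indicesAt m)
  indicesAt-Ascending m = indices-Ascending (interleavingAt m) (proj₁ (proj₂ (stage m (offset m))))

  τ-w-FP : ∀ l (g : Fin (suc l) → ℕ) → StrictlyIncreasing g → FP y (concatF (τ k ∘ w ∘ g))
  τ-w-FP l g g↑ with _ , asc ← concatF-Ascending offset indicesAt indicesAt-Ascending l g g↑ =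
    subst (FP y) (trans (concatMap-concatF y (indicesAt ∘ g)) (sym (concatF-cong (τ-w ∘ g)))) (Ascending⇒FP y asc)

mainTheorem7 : (L : Set) (Alph : ℕ → List L) →
    (∀ i → Alph i ≢ []) →
    (∀ i {a : L} → a ∈ Alph i → a ∈ Alph (suc i)) →
    (∀ (a : L) → ∃[ i ] a ∈ Alph i) →
    (k n : ℕ) → 1 ≤ k → k < n →
    (y : ℕ → List (Fin k)) → (∀ t → InT k (y t)) →
    (D : List⁺ L → Set) → JSet _⁺++⁺_ D →
    Σ (ℕ → Word L n) λ w →
      (∀ m → InS n (w m)) ×
      (∀ m (a : Fin n → L) → (∀ i → a i ∈ Alph m) →
         Σ (List⁺ L) λ u → (toList u ≡ substW (w m) a) × D u) ×
      (∀ l (g : Fin (suc l) → ℕ) → StrictlyIncreasing g →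
         FP y (concatF (τ k ∘ w ∘ g)))
mainTheorem7 L Alph Alph≢[] _ _ k n _ k<n y y∈T D J with Alph 0 | Alph≢[] 0
... | []     | Alph₀≢[] = ⊥-elim (Alph₀≢[] refl)
... | x₀ ∷ _ | _        = w , w∈S y∈T , w-instances , τ-w-FP
  where open Construction L Alph x₀ k n k<n y D J
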